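{- Let $\Gamma$ be a weighted digraph with forest dimension $v$, let $K$ be an undominated knot of $\Gamma$, and let $\mathcal T,\mathcal P,\mathcal T^j,\mathcal P^{K\to i}$ ($j\in K$, $i\in V(\Gamma)$) be determined by $K$. Then 1. $\mathcal F_{n-v}=\mathcal T\odot\mathcal P$ and $\varepsilon(\mathcal F_{n-v})=\varepsilon(\mathcal T)\varepsilon(\mathcal P)$; 2. for any $j\in K$ and $i\in V(\Gamma)$, $\mathcal F^{j\to i}_{n-v}=\mathcal T^j\odot\mathcal P^{K\to i}$ and $\varepsilon(\mathcal F^{j\to i}_{n-v})=\varepsilon(\mathcal T^j)\varepsilon(\mathcal P^{K\to i})$.
   Context: $\Gamma$: loopless digraph on $V(\Gamma)=\{1,\dots,n\}$ with arc weights $\varepsilon_{ij}>0$; weight of a subgraph = product of arc weights (1 if none), weight of a set = sum (0 if empty). $w$ is reachable from $z$ if $w=z$ or there is a directed path from $z$ to $w$. A diverging forest: no circuits, all indegrees $\le1$; roots are indegree-0 vertices; each weak component is a tree diverging from a root. A maximum out forest is a spanning diverging forest with maximum number of arcs; $v$ is its number of roots. $\mathcal F_k$: spanning diverging forests of $\Gamma$ with $k$ arcs; $\mathcal F_k^{j\to i}$: those in which $i$ lies in the tree rooted at $j$. An undominated knot is a nonempty $K\subseteq V(\Gamma)$ whose vertices are mutually reachable with no arc from outside $K$ into $K$. $\Gamma_K$: restriction of $\Gamma$ to $K$; $\Gamma_{ -K}$: spanning subgraph with arc set $E(\Gamma)\setminus E(\Gamma_K)$. $\mathcal T$: spanning diverging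 trees of $\Gamma_K$; $\mathcal T^j$: those diverging from $j$; $\mathcal P$: maximum out forests of $\Gamma_{ -K}$; $\mathcal P^{K\to i}$: those in which $i$ is reachable from some vertex of $K$. $\mathcal T\odot\mathcal P=\{T\cup F: T\in\mathcal T,F\in\mathcal P\}$, where $T\cup F$ has vertex set $V(\Gamma)$ and arc set $E(T)\cup E(F)$; similarly $\mathcal T^j\odot\mathcal P^{K\to i}$. -}

module Defs where

open import Data.Nat using (ℕ; zero; suc; _≤_; _∸_)
open import Data.Nat as ℕ using ()
open import Data.Nat using (_≟_)
open import Data.Fin using (Fin; zero; suc)
open import Data.Bool using (Bool; true; false; _∧_; _∨_; not; if_then_else_)
open import Data.Vec using (lookup)
open import Data.Fin.Subset using (Subset; _∈_; Nonempty)
open import Data.List using (List; []; _∷_; foldr)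
open import Data.List.Relation.Unary.All using (All)
open import Data.List.Relation.Unary.Any using (Any)
open import Data.List.Relation.Unary.AllPairs using (AllPairs)
open import Data.Product using (Σ; ∃; ∃-syntax; _×_; _,_)
open import Relation.Binary.PropositionalEquality using (_≡_)
open import Relation.Nullary using (¬_)
open import Relation.Nullary.Decidable using (⌊_⌋)
open import Algebra.Bundles using (CommutativeSemiring)

-- Digraphs on the vertex set Fin n, given by their arc relation.
-- G x y ≡ true  means: G has the arc x → y.
-- A spanning subgraph of Γ is a Graph n whose arcs are arcs of Γ.

Graph : ℕ → Set
Graph n = Fin n → Fin n → Bool

Loopless : ∀ {n} → Graph n → Set
Loopless G = ∀ x → G x x ≡ false

_⊆ᴳ_ : ∀ {n} → Graph n → Graph n → Set
H ⊆ᴳ G = ∀ x y → H x y ≡ true → G x y ≡ true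

_≐_ : ∀ {n} → Graph n → Graph n → Set
H ≐ G = ∀ x y → H x y ≡ G x y

_∪ᴳ_ : ∀ {n} → Graph n → Graph n → Graph n
(H ∪ᴳ G) x y = H x y ∨ G x y

∑ : ∀ {n} → (Fin n → ℕ) → ℕ
∑ {zero}  f = 0
∑ {suc n} f = f zero ℕ.+ ∑ (λ i → f (suc i))

b2n : Bool → ℕ
b2n true  = 1
b2n false = 0

numArcs : ∀ {n} → Graph n → ℕ
numArcs G = ∑ λ x → ∑ λ y → b2n (G x y)

inDegree : ∀ {n} → Graph n → Fin n → ℕ
inDegree G y = ∑ λ x → b2n (G x y)

IsRoot : ∀ {n} → Graph n → Fin n → Set
IsRoot G y = inDegree G y ≡ 0

numRoots : ∀ {n} → Graph n → ℕ
numRoots G = ∑ λ y → b2n ⌊ inDegree G y ≟ 0 ⌋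

data Reach {n} (G : Graph n) : Fin n → Fin n → Set where
  here : ∀ {z} → Reach G z z
  step : ∀ {z y w} → G z y ≡ true → Reach G y w → Reach G z w

HasCircuit : ∀ {n} → Graph n → Set
HasCircuit G = ∃[ z ] ∃[ y ] (G z y ≡ true × Reach G y z)

DivergingForest : ∀ {n} → Graph n → Set
DivergingForest G = ¬ HasCircuit G × (∀ y → inDegree G y ≤ 1)

SpanningForest : ∀ {n} → Graph n → Graph n → Set
SpanningForest Γ F = F ⊆ᴳ Γ × DivergingForest F

MaxOutForest : ∀ {n} → Graph n → Graph n → Set
MaxOutForest Γ F =
  SpanningForest Γ F × (∀ F′ → SpanningForest Γ F′ → numArcs F′ ≤ numArcs F)

ForestDimension : ∀ {n} → Graph n → ℕ → Set
ForestDimension Γ v = ∃[ F ] (MaxOutForest Γ F × numRoots F ≡ v)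

InTreeRootedAt : ∀ {n} → Graph n → Fin n → Fin n → Set
InTreeRootedAt F j i = IsRoot F j × Reach F j i

𝓕 : ∀ {n} → Graph n → ℕ → Graph n → Set
𝓕 Γ k F = SpanningForest Γ F × numArcs F ≡ k

𝓕[_⇒_] : ∀ {n} → Fin n → Fin n → Graph n → ℕ → Graph n → Set
𝓕[ j ⇒ i ] Γ k F = 𝓕 Γ k F × InTreeRootedAt F j i

UndominatedKnot : ∀ {n} → Graph n → Subset n → Set
UndominatedKnot Γ K =
  Nonempty K
  × (∀ x y → x ∈ K → y ∈ K → Reach Γ x y)
  × (∀ x y → Γ x y ≡ true → y ∈ K → x ∈ K)

-- Γ_K (restriction to K; vertices outside K are isolated / ignored)
restrict : ∀ {n} → Graph n → Subset n → Graph n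
restrict Γ K x y = Γ x y ∧ (lookup K x ∧ lookup K y)

remove : ∀ {n} → Graph n → Subset n → Graph n
remove Γ K x y = Γ x y ∧ not (lookup K x ∧ lookup K y)

-- 𝒯^j : spanning diverging trees of Γ_K diverging from j
-- (arc sets inside K forming a diverging forest in which every vertex
--  of K is reachable from j)
𝒯[_] : ∀ {n} → Fin n → Graph n → Subset n → Graph n → Set
𝒯[ j ] Γ K T =
  T ⊆ᴳ restrict Γ K × DivergingForest T × j ∈ K × (∀ k → k ∈ K → Reach T j k)

𝒯 : ∀ {n} → Graph n → Subset n → Graph n → Set
𝒯 Γ K T = ∃[ j ] 𝒯[ j ] Γ K T

𝒫 : ∀ {n} → Graph n → Subset n → Graph n → Set
𝒫 Γ K F = MaxOutForest (remove Γ K) F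

𝒫[K⇒_] : ∀ {n} → Fin n → Graph n → Subset n → Graph n → Set
𝒫[K⇒ i ] Γ K F = 𝒫 Γ K F × ∃[ z ] (z ∈ K × Reach F z i)

_⊙_ : ∀ {n} → (Graph n → Set) → (Graph n → Set) → Graph n → Set
(𝒜 ⊙ ℬ) S = ∃[ T ] ∃[ F ] (𝒜 T × ℬ F × S ≐ (T ∪ᴳ F))

SameSet : ∀ {n} → (Graph n → Set) → (Graph n → Set) → Set
SameSet 𝒜 ℬ = ∀ S → (𝒜 S → ℬ S) × (ℬ S → 𝒜 S)

Enumerates : ∀ {n} → (Graph n → Set) → List (Graph n) → Set
Enumerates 𝒮 L =
  All 𝒮 L
  × (∀ S → 𝒮 S → Any (λ S′ → S ≐ S′) L)
  × AllPairs (λ S S′ → ¬ (S ≐ S′)) L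

module Weights {c ℓ} (R : CommutativeSemiring c ℓ) where
  open CommutativeSemiring R using (Carrier; _+_; _*_; 0#; 1#)

  ∏ : ∀ {n} → (Fin n → Carrier) → Carrier
  ∏ {zero}  f = 1#
  ∏ {suc n} f = f zero * ∏ (λ i → f (suc i))

  wt : ∀ {n} → (Fin n → Fin n → Carrier) → Graph n → Carrier
  wt ε S = ∏ λ x → ∏ λ y → if S x y then ε x y else 1#

  wtList : ∀ {n} → (Fin n → Fin n → Carrier) → List (Graph n) → Carrier
  wtList ε = foldr (λ S acc → wt ε S + acc) 0#

{-# OPTIONS --safe #-}
module Submission where

-- A maximum out forest F of Γ has a root in K (follow parents from a vertex of K; no arc enters
-- K), and every root r of F reaches in F each vertex x from which r is reachable in Γ: otherwise
-- re-hanging a subtree along a path from x to r gives another maximum out forest with a shorter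
-- such path, or, when the re-hung vertex is r itself, an out forest with more arcs.  As K is
-- strongly connected, F has exactly one root in K, its arcs inside K form a spanning diverging
-- tree of Γ_K and the remaining arcs a maximum out forest of Γ_{-K}.  Conversely, a circuit of Γ
-- cannot leave K and come back, so any such tree and forest glue to a diverging forest with
-- (|K| − 1) + (size of a maximum out forest of Γ_{-K}) arcs, the size n − v of F.  Splitting
-- S into S_K ∪ S_{-K} is unique, so the weighted sums over enumerations multiply.

open import Defs
open import Algebra.Bundles using (CommutativeSemiring)
import Algebra.Properties.CommutativeMonoid.Sum as CommutativeMonoidSum
open import Data.Bool using (Bool; true; false; _∧_; _∨_; not; if_then_else_)
open import Data.Bool.Properties
  using (∧-conicalˡ; ∧-conicalʳ; ∧-zeroʳ; ∧-identityʳ; ∨-zeroʳ; not-injective)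
open import Data.Fin.Subset using (Subset; _∈_)
open import Data.Vec using (lookup)
open import Data.Vec.Properties using ([]=⇒lookup; lookup⇒[]=)
open import Data.Empty using (⊥; ⊥-elim)
open import Data.Fin using (Fin; zero; suc; toℕ)
open import Data.Fin.Properties using (pigeonhole; toℕ<n) renaming (_≟_ to _≟ᶠ_)
open import Data.Nat using (ℕ; zero; suc; 2+; _+_; _∸_; _≤_; _<_; _≤′_; ≤′-refl; ≤′-step; z≤n; s≤s; _≟_)
open import Data.Nat.Properties
  using (+-0-commutativeMonoid; +-mono-≤; +-identityʳ; +-comm; +-cancelˡ-≤; +-cancelʳ-≡;
         ≤-refl; ≤-reflexive; ≤-trans; ≤-antisym; ≤-pred; ≤⇒≤′; <⇒≤; <-irrefl;
         m≤m+n; m≤n+m; m+n∸n≡m; n<1+n; module ≤-Reasoning)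
open import Data.Product using (Σ; ∃-syntax; _×_; _,_; proj₁; proj₂)
open import Data.Sum using (_⊎_; inj₁; inj₂; reduce)
import Data.Sum
open import Function using (_∘_; id)
open import Data.List using (List; []; _∷_; _++_; map; foldr; cartesianProductWith)
open import Data.List.Properties using (foldr-map)
open import Data.List.Relation.Unary.All using (All; []; _∷_; lookupAny)
open import Data.List.Relation.Unary.Any using (here; there)
import Data.List.Relation.Unary.All as All
import Data.List.Relation.Unary.All.Properties as AllProperties
import Data.List.Relation.Unary.AllPairs as AllPairs
open import Data.List.Relation.Unary.AllPairs using (AllPairs; []; _∷_)
import Data.List.Relation.Unary.AllPairs.Properties as AllPairsProperties
import Data.List.Membership.Setoid as Membership
import Data.List.Membership.Setoid.Properties as MembershipProperties
import Data.List.Relation.Unary.Unique.Setoid as UniqueSetoid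
import Data.List.Relation.Binary.Permutation.Setoid as Permutation
import Data.List.Relation.Binary.Permutation.Setoid.Properties as PermutationProperties
open import Relation.Binary.Bundles using (Setoid)
import Relation.Binary.Reasoning.Setoid
open import Level using (0ℓ)
open import Relation.Binary.PropositionalEquality
  using (_≡_; _≢_; refl; sym; trans; cong; cong₂; subst; module ≡-Reasoning)
import Relation.Binary.PropositionalEquality as ≡
open import Relation.Nullary using (¬_)
open import Relation.Nullary.Decidable
  using (⌊_⌋; does; yes; no; Dec; dec-true; dec-false; decidable-stable)

module ℕSum = CommutativeMonoidSum +-0-commutativeMonoid

∑≡sum : ∀ {n} (f : Fin n → ℕ) → ∑ f ≡ ℕSum.sum f
∑≡sum {zero}  f = refl
∑≡sum {suc n} f = cong (f zero +_) (∑≡sum (f ∘ suc))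

∑-cong : ∀ {n} {f g : Fin n → ℕ} → (∀ i → f i ≡ g i) → ∑ f ≡ ∑ g
∑-cong {zero}  f≗g = refl
∑-cong {suc n} f≗g = cong₂ _+_ (f≗g zero) (∑-cong (f≗g ∘ suc))

∑-distrib-+ : ∀ {n} (f g : Fin n → ℕ) → ∑ (λ i → f i + g i) ≡ ∑ f + ∑ g
∑-distrib-+ f g = begin
  ∑ (λ i → f i + g i)           ≡⟨ ∑≡sum (λ i → f i + g i) ⟩
  ℕSum.sum (λ i → f i + g i)    ≡⟨ ℕSum.∑-distrib-+ f g ⟩
  ℕSum.sum f + ℕSum.sum g       ≡⟨ sym (cong₂ _+_ (∑≡sum f) (∑≡sum g)) ⟩
  ∑ f + ∑ g                     ∎
  where open ≡-Reasoning

∑-comm : ∀ {m n} (f : Fin m → Fin n → ℕ) →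
         ∑ (λ i → ∑ (λ j → f i j)) ≡ ∑ (λ j → ∑ (λ i → f i j))
∑-comm f = begin
  ∑ (λ i → ∑ (f i))                        ≡⟨ ∑-cong (λ i → ∑≡sum (f i)) ⟩
  ∑ (λ i → ℕSum.sum (f i))                 ≡⟨ ∑≡sum (ℕSum.sum ∘ f) ⟩
  ℕSum.sum (λ i → ℕSum.sum (f i))          ≡⟨ ℕSum.∑-comm f ⟩
  ℕSum.sum (λ j → ℕSum.sum (λ i → f i j))  ≡⟨ sym (∑≡sum (λ j → ℕSum.sum (λ i → f i j))) ⟩
  ∑ (λ j → ℕSum.sum (λ i → f i j))         ≡⟨ sym (∑-cong (λ j → ∑≡sum (λ i → f i j))) ⟩
  ∑ (λ j → ∑ (λ i → f i j))                ∎
  where open ≡-Reasoning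

∑-zero : ∀ n → ∑ {n} (λ _ → 0) ≡ 0
∑-zero zero    = refl
∑-zero (suc n) = ∑-zero n

∑-one : ∀ n → ∑ {n} (λ _ → 1) ≡ n
∑-one zero    = refl
∑-one (suc n) = cong suc (∑-one n)

∑-mono-≤ : ∀ {n} {f g : Fin n → ℕ} → (∀ i → f i ≤ g i) → ∑ f ≤ ∑ g
∑-mono-≤ {zero}  f≤g = z≤n
∑-mono-≤ {suc n} f≤g = +-mono-≤ (f≤g zero) (∑-mono-≤ (f≤g ∘ suc))

term≤∑ : ∀ {n} (f : Fin n → ℕ) i → f i ≤ ∑ f
term≤∑ f zero    = m≤m+n _ _
term≤∑ f (suc i) = ≤-trans (term≤∑ (f ∘ suc) i) (m≤n+m _ _)

∑-indicator : ∀ {n} (w : Fin n) → ∑ (λ b → b2n (does (b ≟ᶠ w))) ≡ 1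
∑-indicator {suc n} zero    = cong suc (∑-zero n)
∑-indicator {suc n} (suc w) = ∑-indicator w

∑-b2n≢0⇒true : ∀ {n} (g : Fin n → Bool) → ∑ (λ i → b2n (g i)) ≢ 0 → ∃[ i ] g i ≡ true
∑-b2n≢0⇒true {zero}  g ∑≢0 = ⊥-elim (∑≢0 refl)
∑-b2n≢0⇒true {suc n} g ∑≢0 with g zero in g₀
... | true  = zero , g₀
... | false = let i , gᵢ = ∑-b2n≢0⇒true (g ∘ suc) ∑≢0 in suc i , gᵢ

module _ {a ℓ} (S : Setoid a ℓ) where

  open Setoid S using (_≈_) renaming (refl to ≈-refl; sym to ≈-sym; trans to ≈-trans)
  open Membership S using () renaming (_∈_ to _∈ₛ_)
  open MembershipProperties using (∈-∃++; ∈-resp-≈; All[≉]⇒∉)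
  open UniqueSetoid S using (Unique)
  open Permutation S using (_↭_; prep; ↭-refl; ↭-sym; ↭-trans; ↭-reflexive-≋)
  open PermutationProperties S using (↭-shift; ∈-resp-↭; Unique-resp-↭)

  unique-sameMembers⇒↭ : ∀ {xs ys} → Unique xs → Unique ys →
                         (∀ {x} → x ∈ₛ xs → x ∈ₛ ys) → (∀ {y} → y ∈ₛ ys → y ∈ₛ xs) → xs ↭ ys
  unique-sameMembers⇒↭ {[]} {[]}    _ _ _ _ = ↭-refl
  unique-sameMembers⇒↭ {[]} {_ ∷ _} _ _ _ ys⊆xs with () ← ys⊆xs (here ≈-refl)
  unique-sameMembers⇒↭ {x ∷ xs} {ys} (x∉xs ∷ xs!) ys! xs⊆ys ys⊆xs
    with as , bs , w , x≈w , ys≋ ← ∈-∃++ S (xs⊆ys (here ≈-refl)) =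
    ↭-trans (prep x≈w (unique-sameMembers⇒↭ xs! ys′! xs⊆ys′ ys′⊆xs)) (↭-sym ys↭)
    where
    ys′ = as ++ bs
    ys↭ : ys ↭ w ∷ ys′
    ys↭ = ↭-trans (↭-reflexive-≋ ys≋) (↭-shift as bs)
    w∷ys′! : Unique (w ∷ ys′)
    w∷ys′! = Unique-resp-↭ ys↭ ys!
    ys′! : Unique ys′
    ys′! = AllPairs.tail w∷ys′!
    xs⊆ys′ : ∀ {z} → z ∈ₛ xs → z ∈ₛ ys′
    xs⊆ys′ {z} z∈xs with ∈-resp-↭ ys↭ (xs⊆ys (there z∈xs))
    ... | here z≈w    = ⊥-elim (All[≉]⇒∉ S x∉xs (∈-resp-≈ S (≈-trans z≈w (≈-sym x≈w)) z∈xs))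
    ... | there z∈ys′ = z∈ys′
    ys′⊆xs : ∀ {z} → z ∈ₛ ys′ → z ∈ₛ xs
    ys′⊆xs {z} z∈ys′ with ys⊆xs (∈-resp-↭ (↭-sym ys↭) (there z∈ys′))
    ... | here z≈x   = ⊥-elim (All[≉]⇒∉ S (AllPairs.head w∷ys′!) (∈-resp-≈ S (≈-trans z≈x x≈w) z∈ys′))
    ... | there z∈xs = z∈xs

≐-refl : ∀ {n} {G : Graph n} → G ≐ G
≐-refl x y = refl

≐-sym : ∀ {n} {G H : Graph n} → G ≐ H → H ≐ G
≐-sym G≐H x y = sym (G≐H x y)

≐-trans : ∀ {n} {G H I : Graph n} → G ≐ H → H ≐ I → G ≐ I
≐-trans G≐H H≐I x y = trans (G≐H x y) (H≐I x y)

≐⇒⊆ᴳ : ∀ {n} {G H : Graph n} → G ≐ H → G ⊆ᴳ H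
≐⇒⊆ᴳ G≐H x y Gxy = trans (sym (G≐H x y)) Gxy

≐-setoid : ℕ → Setoid 0ℓ 0ℓ
≐-setoid n = record
  { Carrier       = Graph n
  ; _≈_           = _≐_
  ; isEquivalence = record { refl = ≐-refl ; sym = ≐-sym ; trans = ≐-trans }
  }

∪-⊆ˡ : ∀ {n} {T P : Graph n} → T ⊆ᴳ (T ∪ᴳ P)
∪-⊆ˡ x y x→y rewrite x→y = refl

∪-⊆ʳ : ∀ {n} {T P : Graph n} → P ⊆ᴳ (T ∪ᴳ P)
∪-⊆ʳ {T = T} x y x→y rewrite x→y = ∨-zeroʳ (T x y)

∪-⊆ : ∀ {n} {T P G : Graph n} → T ⊆ᴳ G → P ⊆ᴳ G → (T ∪ᴳ P) ⊆ᴳ G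
∪-⊆ {T = T} T⊆G P⊆G x y x→y with T x y in T-x→y
... | true  = T⊆G x y T-x→y
... | false = P⊆G x y x→y

∪-cong : ∀ {n} {T T′ P P′ : Graph n} → T ≐ T′ → P ≐ P′ → (T ∪ᴳ P) ≐ (T′ ∪ᴳ P′)
∪-cong T≐T′ P≐P′ x y = cong₂ _∨_ (T≐T′ x y) (P≐P′ x y)

_⊗_ : ∀ {n} → List (Graph n) → List (Graph n) → List (Graph n)
_⊗_ = cartesianProductWith _∪ᴳ_

All-⊗ : ∀ {n a b q} {A : Graph n → Set a} {B : Graph n → Set b} {Q : Graph n → Set q} {Ts Ps} →
        All A Ts → All B Ps → (∀ {T P} → A T → B P → Q (T ∪ᴳ P)) → All Q (Ts ⊗ Ps)
All-⊗ {Ts = Ts} {Ps} A-Ts B-Ps Q-∪ =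
  AllProperties.cartesianProductWith⁺ (≡.setoid _) (≡.setoid _) _∪ᴳ_ Ts Ps
    (λ T∈Ts P∈Ps → Q-∪ (All.lookup A-Ts T∈Ts) (All.lookup B-Ps P∈Ps))

numArcs≡∑inDegree : ∀ {n} (G : Graph n) → numArcs G ≡ ∑ (inDegree G)
numArcs≡∑inDegree G = ∑-comm (λ x y → b2n (G x y))

module _ {n} {G : Graph n} where

  Reach-trans : ∀ {a b c} → Reach G a b → Reach G b c → Reach G a c
  Reach-trans here       b⇝c = b⇝c
  Reach-trans (step e p) b⇝c = step e (Reach-trans p b⇝c)

  Reach-mono : ∀ {H} → G ⊆ᴳ H → ∀ {a b} → Reach G a b → Reach H a b
  Reach-mono G⊆H here       = here
  Reach-mono G⊆H (step e p) = step (G⊆H _ _ e) (Reach-mono G⊆H p)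

  Reach-last : ∀ {a b} → Reach G a b → a ≢ b → ∃[ c ] (Reach G a c × G c b ≡ true)
  Reach-last here a≢a = ⊥-elim (a≢a refl)
  Reach-last {a} {b} (step {y = y} a→y y⇝b) a≢b with y ≟ᶠ b
  ... | yes refl = a , here , a→y
  ... | no y≢b   = let c , y⇝c , c→b = Reach-last y⇝b y≢b in c , step a→y y⇝c , c→b

  HasCircuit-mono : ∀ {H} → G ⊆ᴳ H → HasCircuit G → HasCircuit H
  HasCircuit-mono G⊆H (z , y , z→y , y⇝z) = z , y , G⊆H z y z→y , Reach-mono G⊆H y⇝z

  inDegree-mono : ∀ {H} → G ⊆ᴳ H → ∀ y → inDegree G y ≤ inDegree H y
  inDegree-mono G⊆H y = ∑-mono-≤ (λ x → b2n-mono (G⊆H x y))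
    where
    b2n-mono : ∀ {a b} → (a ≡ true → b ≡ true) → b2n a ≤ b2n b
    b2n-mono {false} _   = z≤n
    b2n-mono {true}  a⇒b rewrite a⇒b refl = ≤-refl

  inDegree-cong : ∀ {H} → G ≐ H → ∀ y → inDegree G y ≡ inDegree H y
  inDegree-cong G≐H y = ∑-cong (λ x → cong b2n (G≐H x y))

  numArcs-cong : ∀ {H} → G ≐ H → numArcs G ≡ numArcs H
  numArcs-cong G≐H = ∑-cong (λ x → ∑-cong (λ y → cong b2n (G≐H x y)))

  arc⇒1≤inDegree : ∀ {x y} → G x y ≡ true → 1 ≤ inDegree G y
  arc⇒1≤inDegree {x} {y} x→y = subst (_≤ inDegree G y) (cong b2n x→y) (term≤∑ (λ x → b2n (G x y)) x)

  noArc⇒IsRoot : ∀ {y} → (∀ x → G x y ≡ false) → IsRoot G y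
  noArc⇒IsRoot {y} no-arc = trans (∑-cong (λ x → cong b2n (no-arc x))) (∑-zero n)

  IsRoot⇒noArc : ∀ {x y} → IsRoot G y → G x y ≢ true
  IsRoot⇒noArc y-root x→y with () ← ≤-trans (arc⇒1≤inDegree x→y) (≤-reflexive y-root)

  ¬IsRoot⇒parent : ∀ {y} → ¬ IsRoot G y → ∃[ x ] G x y ≡ true
  ¬IsRoot⇒parent {y} = ∑-b2n≢0⇒true (λ x → G x y)

  Reach-root : ∀ {a r} → IsRoot G r → Reach G a r → a ≡ r
  Reach-root {a} {r} r-root a⇝r with a ≟ᶠ r
  ... | yes a≡r = a≡r
  ... | no a≢r  = let _ , _ , c→r = Reach-last a⇝r a≢r in ⊥-elim (IsRoot⇒noArc r-root c→r)

  numArcs+numRoots : (∀ y → inDegree G y ≤ 1) → numArcs G + numRoots G ≡ n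
  numArcs+numRoots inDegree≤1 = begin
    numArcs G + numRoots G                                ≡⟨ cong (_+ numRoots G) (numArcs≡∑inDegree G) ⟩
    ∑ (inDegree G) + numRoots G                           ≡⟨ sym (∑-distrib-+ (inDegree G) _) ⟩
    ∑ (λ y → inDegree G y + b2n ⌊ inDegree G y ≟ 0 ⌋)     ≡⟨ ∑-cong (λ y → k+[k≡0]≡1 (inDegree≤1 y)) ⟩
    ∑ {n} (λ _ → 1)                                       ≡⟨ ∑-one n ⟩
    n                                                     ∎
    where
    open ≡-Reasoning
    k+[k≡0]≡1 : ∀ {k} → k ≤ 1 → k + b2n ⌊ k ≟ 0 ⌋ ≡ 1
    k+[k≡0]≡1 {0}     _ = refl
    k+[k≡0]≡1 {1}     _ = refl
    k+[k≡0]≡1 {2+ _} (s≤s ())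

∸numRoots≡numArcs : ∀ {n} {G : Graph n} → DivergingForest G → n ∸ numRoots G ≡ numArcs G
∸numRoots≡numArcs {n} {G} (_ , inDegree≤1) =
  trans (cong (_∸ numRoots G) (sym (numArcs+numRoots inDegree≤1))) (m+n∸n≡m (numArcs G) (numRoots G))

DivergingForest-mono : ∀ {n} {G H : Graph n} → G ⊆ᴳ H → DivergingForest H → DivergingForest G
DivergingForest-mono G⊆H (H-acyclic , H-inDegree≤1) =
  H-acyclic ∘ HasCircuit-mono G⊆H , λ y → ≤-trans (inDegree-mono G⊆H y) (H-inDegree≤1 y)

SpanningForest-mono : ∀ {n} {Γ G H : Graph n} → G ⊆ᴳ H → SpanningForest Γ H → SpanningForest Γ G
SpanningForest-mono G⊆H (H⊆Γ , H-forest) =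
  (λ x y x→y → H⊆Γ x y (G⊆H x y x→y)) , DivergingForest-mono G⊆H H-forest

maxOutForest-numArcs : ∀ {n} {Γ F F′ : Graph n} → MaxOutForest Γ F → MaxOutForest Γ F′ →
                       numArcs F ≡ numArcs F′
maxOutForest-numArcs (F-forest , F-max) (F′-forest , F′-max) =
  ≤-antisym (F′-max _ F-forest) (F-max _ F′-forest)

module _ {n} {G : Graph n} where

  RootedAbove : Fin n → Set
  RootedAbove y = ∃[ r ] (IsRoot G r × Reach G r y)

  BackWalk : ℕ → Fin n → Set
  BackWalk m y = Σ (ℕ → Fin n) λ w → w 0 ≡ y × (∀ {i} → i < m → G (w (suc i)) (w i) ≡ true)

  rootedAbove-or-backWalk : ∀ m y → RootedAbove y ⊎ BackWalk m y
  rootedAbove-or-backWalk zero    y = inj₂ ((λ _ → y) , refl , λ ())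
  rootedAbove-or-backWalk (suc m) y with inDegree G y ≟ 0
  ... | yes y-root = inj₁ (y , y-root , here)
  ... | no ¬y-root with ¬IsRoot⇒parent {G = G} ¬y-root
  ... | x , x→y with rootedAbove-or-backWalk m x
  ... | inj₁ (r , r-root , r⇝x) = inj₁ (r , r-root , Reach-trans {G = G} r⇝x (step x→y here))
  ... | inj₂ (w , w₀≡x , w-arcs) = inj₂ (w′ , refl , w′-arcs)
    where
    w′ : ℕ → Fin n
    w′ zero    = y
    w′ (suc i) = w i
    w′-arcs : ∀ {i} → i < suc m → G (w′ (suc i)) (w′ i) ≡ true
    w′-arcs {zero}  _         = subst (λ z → G z y ≡ true) (sym w₀≡x) x→y
    w′-arcs {suc i} (s≤s i<m) = w-arcs i<m

  backWalk-reach : ∀ {m} (w : ℕ → Fin n) → (∀ {i} → i < m → G (w (suc i)) (w i) ≡ true) →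
                   ∀ {i j} → i ≤′ j → j ≤ m → Reach G (w j) (w i)
  backWalk-reach w w-arcs ≤′-refl          j≤m = here
  backWalk-reach w w-arcs (≤′-step i≤′j) j<m = step (w-arcs j<m) (backWalk-reach w w-arcs i≤′j (<⇒≤ j<m))

  backWalk⇒circuit : ∀ {y} → BackWalk n y → HasCircuit G
  backWalk⇒circuit (w , _ , w-arcs) with pigeonhole (n<1+n n) (w ∘ toℕ)
  ... | i , j , i<j , wᵢ≡wⱼ = circuit (toℕ i) (toℕ j) i<j (≤-pred (toℕ<n j)) wᵢ≡wⱼ
    where
    circuit : ∀ i j → i < j → j ≤ n → w i ≡ w j → HasCircuit G
    circuit i (suc t) (s≤s i≤t) j≤n wᵢ≡wⱼ =
      w (suc t) , w t , w-arcs j≤n ,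
      subst (Reach G (w t)) wᵢ≡wⱼ (backWalk-reach w w-arcs (≤⇒≤′ i≤t) (<⇒≤ j≤n))

  rootedAbove : ¬ HasCircuit G → ∀ y → RootedAbove y
  rootedAbove acyclic y with rootedAbove-or-backWalk n y
  ... | inj₁ rooted = rooted
  ... | inj₂ walk   = ⊥-elim (acyclic (backWalk⇒circuit walk))

-- Re-hanging a vertex below another one

redirect : ∀ {n} → Graph n → Fin n → Fin n → Graph n
redirect G u w a b = if does (b ≟ᶠ w) then does (a ≟ᶠ u) else G a b

module _ {n} {G : Graph n} {u w : Fin n} where

  private
    G′ = redirect G u w

  redirect-arc : ∀ {a b} → G′ a b ≡ true → G a b ≡ true ⊎ (a ≡ u × b ≡ w)
  redirect-arc {a} {b} a→b with b ≟ᶠ w | a ≟ᶠ u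
  ... | yes b≡w | yes a≡u = inj₂ (a≡u , b≡w)
  ... | no _    | _       = inj₁ a→b

  redirect-arc-target : ∀ {a} → G′ a w ≡ true → a ≡ u
  redirect-arc-target {a} a→w with w ≟ᶠ w | a ≟ᶠ u
  ... | yes _   | yes a≡u = a≡u
  ... | no w≢w  | _       = ⊥-elim (w≢w refl)

  redirect-other : ∀ {a b} → b ≢ w → G′ a b ≡ G a b
  redirect-other {a} {b} b≢w with b ≟ᶠ w
  ... | yes b≡w = ⊥-elim (b≢w b≡w)
  ... | no _    = refl

  inDegree-redirect-target : inDegree G′ w ≡ 1
  inDegree-redirect-target with w ≟ᶠ w
  ... | yes _   = ∑-indicator u
  ... | no w≢w  = ⊥-elim (w≢w refl)

  inDegree-redirect-other : ∀ {b} → b ≢ w → inDegree G′ b ≡ inDegree G b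
  inDegree-redirect-other {b} b≢w = ∑-cong (λ a → cong b2n (redirect-other {a} {b} b≢w))

  inDegree-redirect : ∀ b → (b ≡ w × inDegree G′ b ≡ 1) ⊎ (b ≢ w × inDegree G′ b ≡ inDegree G b)
  inDegree-redirect b with w ≟ᶠ b
  ... | yes refl = inj₁ (refl , inDegree-redirect-target)
  ... | no w≢b   = inj₂ (w≢b ∘ sym , inDegree-redirect-other (w≢b ∘ sym))

  -- Cut the walk just before its first use of the new arc u → w.
  Reach-redirect : ∀ {a b} → Reach G′ a b → Reach G a b ⊎ Reach G a u
  Reach-redirect here = inj₁ here
  Reach-redirect {a} (step {y = y} a→y y⇝b) with redirect-arc {a} {y} a→y | Reach-redirect y⇝b
  ... | inj₂ (refl , _) | _          = inj₂ here
  ... | inj₁ a→y′       | inj₁ y⇝b′  = inj₁ (step a→y′ y⇝b′)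
  ... | inj₁ a→y′       | inj₂ y⇝u   = inj₂ (step a→y′ y⇝u)

  Reach-redirect-last : ∀ {a b} → Reach G′ a b → Reach G a b ⊎ Reach G w b
  Reach-redirect-last here = inj₁ here
  Reach-redirect-last {a} (step {y = y} a→y y⇝b) with Reach-redirect-last y⇝b
  ... | inj₂ w⇝b = inj₂ w⇝b
  ... | inj₁ y⇝b with redirect-arc {a} {y} a→y
  ...   | inj₁ a→y′       = inj₁ (step a→y′ y⇝b)
  ...   | inj₂ (_ , refl) = inj₂ y⇝b

  Reach-redirect-target : ∀ {a} → Reach G′ a w → a ≢ w → Reach G a u
  Reach-redirect-target a⇝w a≢w with Reach-last a⇝w a≢w
  ... | c , a⇝c , c→w with redirect-arc-target {c} c→w
  ...   | refl = reduce (Reach-redirect a⇝c)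

  redirect-acyclic : ¬ HasCircuit G → ¬ Reach G w u → ¬ HasCircuit G′
  redirect-acyclic G-acyclic ¬w⇝u (z , y , z→y , y⇝z) with redirect-arc {z} {y} z→y
  ... | inj₂ (refl , refl) = ¬w⇝u (reduce (Reach-redirect y⇝z))
  ... | inj₁ z→y′ with Reach-redirect y⇝z | Reach-redirect-last y⇝z
  ...   | inj₁ y⇝z′ | _         = G-acyclic (z , y , z→y′ , y⇝z′)
  ...   | inj₂ _    | inj₁ y⇝z′ = G-acyclic (z , y , z→y′ , y⇝z′)
  ...   | inj₂ y⇝u  | inj₂ w⇝z  = ¬w⇝u (Reach-trans w⇝z (step z→y′ y⇝u))

  redirect-spanningForest : ∀ {Γ} → SpanningForest Γ G → Γ u w ≡ true → ¬ Reach G w u →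
                            SpanningForest Γ G′
  redirect-spanningForest {Γ} (G⊆Γ , G-acyclic , G-inDegree≤1) u→w ¬w⇝u =
    G′⊆Γ , redirect-acyclic G-acyclic ¬w⇝u , G′-inDegree≤1
    where
    G′⊆Γ : G′ ⊆ᴳ Γ
    G′⊆Γ a b a→b with redirect-arc {a} {b} a→b
    ... | inj₁ a→b′         = G⊆Γ a b a→b′
    ... | inj₂ (refl , refl) = u→w
    G′-inDegree≤1 : ∀ b → inDegree G′ b ≤ 1
    G′-inDegree≤1 b with inDegree-redirect b
    ... | inj₁ (_ , G′-inDegree) = ≤-reflexive G′-inDegree
    ... | inj₂ (_ , G′-inDegree) = subst (_≤ 1) (sym G′-inDegree) (G-inDegree≤1 b)

  numArcs-redirect-≤ : inDegree G w ≤ 1 → numArcs G ≤ numArcs G′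
  numArcs-redirect-≤ w-inDegree≤1 = begin
    numArcs G       ≡⟨ numArcs≡∑inDegree G ⟩
    ∑ (inDegree G)  ≤⟨ ∑-mono-≤ inDegree≤ ⟩
    ∑ (inDegree G′) ≡⟨ sym (numArcs≡∑inDegree G′) ⟩
    numArcs G′      ∎
    where
    open ≤-Reasoning
    inDegree≤ : ∀ b → inDegree G b ≤ inDegree G′ b
    inDegree≤ b with inDegree-redirect b
    ... | inj₁ (refl , G′-inDegree) = subst (inDegree G w ≤_) (sym G′-inDegree) w-inDegree≤1
    ... | inj₂ (_ , G′-inDegree)    = ≤-reflexive (sym G′-inDegree)

  numArcs-redirect-root : IsRoot G w → numArcs G′ ≡ suc (numArcs G)
  numArcs-redirect-root w-root = begin
    numArcs G′                                      ≡⟨ numArcs≡∑inDegree G′ ⟩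
    ∑ (inDegree G′)                                 ≡⟨ ∑-cong inDegree≡ ⟩
    ∑ (λ b → inDegree G b + b2n (does (b ≟ᶠ w)))    ≡⟨ ∑-distrib-+ (inDegree G) _ ⟩
    ∑ (inDegree G) + ∑ (λ b → b2n (does (b ≟ᶠ w)))  ≡⟨ cong₂ _+_ (sym (numArcs≡∑inDegree G))
                                                                 (∑-indicator w) ⟩
    numArcs G + 1                                   ≡⟨ +-comm (numArcs G) 1 ⟩
    suc (numArcs G)                                 ∎
    where
    open ≡-Reasoning
    inDegree≡ : ∀ b → inDegree G′ b ≡ inDegree G b + b2n (does (b ≟ᶠ w))
    inDegree≡ b with inDegree-redirect b
    ... | inj₁ (refl , G′-inDegree) =
      trans G′-inDegree (cong₂ (λ k d → k + b2n d) (sym w-root) (sym (dec-true (w ≟ᶠ w) refl)))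
    ... | inj₂ (b≢w , G′-inDegree) =
      trans G′-inDegree
            (sym (trans (cong (λ d → inDegree G b + b2n d) (dec-false (b ≟ᶠ w) b≢w)) (+-identityʳ _)))

  redirect-maxOutForest : ∀ {Γ} → MaxOutForest Γ G → Γ u w ≡ true → ¬ Reach G w u →
                          MaxOutForest Γ G′
  redirect-maxOutForest (G-forest , G-max) u→w ¬w⇝u =
    redirect-spanningForest G-forest u→w ¬w⇝u ,
    λ F F-forest → ≤-trans (G-max F F-forest) (numArcs-redirect-≤ (proj₂ (proj₂ G-forest) w))

  maxOutForest⇒¬IsRoot : ∀ {Γ} → MaxOutForest Γ G → Γ u w ≡ true → ¬ Reach G w u → ¬ IsRoot G w
  maxOutForest⇒¬IsRoot (G-forest , G-max) u→w ¬w⇝u w-root = <-irrefl refl (begin-strict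
    numArcs G   <⟨ n<1+n (numArcs G) ⟩
    suc (numArcs G) ≡⟨ sym (numArcs-redirect-root w-root) ⟩
    numArcs G′  ≤⟨ G-max G′ (redirect-spanningForest G-forest u→w ¬w⇝u) ⟩
    numArcs G   ∎)
    where open ≤-Reasoning

-- If r did not reach x, where x → y starts the path to r, re-hanging y below x would give a
-- maximum out forest in which r is still a root not reaching y (or, when y = r, one with more
-- arcs), and the path from y to r is shorter.  Reachability is not decided, hence ¬ ¬; this
-- suffices because roots are then compared with decidable equality.
maxOutForest-root-reaches : ∀ {n} {Γ G : Graph n} {r x} → MaxOutForest Γ G → IsRoot G r →
                            Reach Γ x r → ¬ ¬ Reach G r x
maxOutForest-root-reaches G-max r-root here ¬r⇝x = ¬r⇝x here
maxOutForest-root-reaches {G = G} {r} {x} G-max r-root (step {y = y} x→y y⇝r) ¬r⇝x =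
  maxOutForest-root-reaches G-max r-root y⇝r ¬r⇝y
  where
  ¬r⇝y : ¬ Reach G r y
  ¬r⇝y r⇝y = rehang (y ≟ᶠ r) (¬r⇝x ∘ Reach-trans r⇝y)
    where
    rehang : Dec (y ≡ r) → ¬ Reach G y x → ⊥
    rehang (yes refl) ¬y⇝x = maxOutForest⇒¬IsRoot G-max x→y ¬y⇝x r-root
    rehang (no y≢r)   ¬y⇝x =
      maxOutForest-root-reaches (redirect-maxOutForest G-max x→y ¬y⇝x)
        (trans (inDegree-redirect-other {G = G} (y≢r ∘ sym)) r-root) y⇝r
        (λ r⇝′y → ¬r⇝x (Reach-redirect-target r⇝′y (y≢r ∘ sym)))

∧-monoˡ : ∀ {a b c} → (a ≡ true → b ≡ true) → a ∧ c ≡ true → b ∧ c ≡ true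
∧-monoˡ {true} a⇒b a∧c rewrite a⇒b refl = a∧c

module Restriction {n} (K : Subset n) where

  inside : Fin n → Fin n → Bool
  inside x y = lookup K x ∧ lookup K y

  restrict-⊆ : ∀ {G : Graph n} → restrict G K ⊆ᴳ G
  restrict-⊆ {G} x y = ∧-conicalˡ (G x y) _

  remove-⊆ : ∀ {G : Graph n} → remove G K ⊆ᴳ G
  remove-⊆ {G} x y = ∧-conicalˡ (G x y) _

  restrict-mono : ∀ {G H : Graph n} → G ⊆ᴳ H → restrict G K ⊆ᴳ restrict H K
  restrict-mono G⊆H x y = ∧-monoˡ (G⊆H x y)

  remove-mono : ∀ {G H : Graph n} → G ⊆ᴳ H → remove G K ⊆ᴳ remove H K
  remove-mono G⊆H x y = ∧-monoˡ (G⊆H x y)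

  restrict-cong : ∀ {G H : Graph n} → G ≐ H → restrict G K ≐ restrict H K
  restrict-cong G≐H x y = cong (_∧ inside x y) (G≐H x y)

  remove-cong : ∀ {G H : Graph n} → G ≐ H → remove G K ≐ remove H K
  remove-cong G≐H x y = cong (_∧ not (inside x y)) (G≐H x y)

  restrict-inside : ∀ {G : Graph n} {x y} → restrict G K x y ≡ true → inside x y ≡ true
  restrict-inside {G} {x} {y} = ∧-conicalʳ (G x y) _

  remove-outside : ∀ {G : Graph n} {x y} → remove G K x y ≡ true → inside x y ≡ false
  remove-outside {G} {x} {y} = not-injective ∘ ∧-conicalʳ (G x y) _

  restrict-arc : ∀ {G : Graph n} {x y} → G x y ≡ true → inside x y ≡ true → restrict G K x y ≡ true
  restrict-arc = cong₂ _∧_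

  remove-arc : ∀ {G : Graph n} {x y} → G x y ≡ true → inside x y ≡ false → remove G K x y ≡ true
  remove-arc x→y outside = cong₂ _∧_ x→y (cong not outside)

  restrict∪remove : ∀ (G : Graph n) → G ≐ (restrict G K ∪ᴳ remove G K)
  restrict∪remove G x y = split (G x y) (inside x y)
    where
    split : ∀ f k → f ≡ (f ∧ k) ∨ (f ∧ not k)
    split false _     = refl
    split true  false = refl
    split true  true  = refl

  numArcs-restrict+remove : ∀ (G : Graph n) → numArcs G ≡ numArcs (restrict G K) + numArcs (remove G K)
  numArcs-restrict+remove G = begin
    numArcs G
      ≡⟨ ∑-cong (λ x → ∑-cong (λ y → split (G x y) (inside x y))) ⟩
    ∑ (λ x → ∑ (λ y → b2n (restrict G K x y) + b2n (remove G K x y)))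
      ≡⟨ ∑-cong (λ x → ∑-distrib-+ (λ y → b2n (restrict G K x y)) _) ⟩
    ∑ (λ x → ∑ (λ y → b2n (restrict G K x y)) + ∑ (λ y → b2n (remove G K x y)))
      ≡⟨ ∑-distrib-+ (λ x → ∑ (λ y → b2n (restrict G K x y))) _ ⟩
    numArcs (restrict G K) + numArcs (remove G K)      ∎
    where
    open ≡-Reasoning
    split : ∀ f k → b2n f ≡ b2n (f ∧ k) + b2n (f ∧ not k)
    split false _     = refl
    split true  false = refl
    split true  true  = refl

  inDegree-remove : ∀ {G : Graph n} {y} → lookup K y ≡ false → inDegree (remove G K) y ≡ inDegree G y
  inDegree-remove {G} {y} y∉K = ∑-cong λ x →
    cong b2n (trans (cong (λ k → G x y ∧ not k) (trans (cong (lookup K x ∧_) y∉K) (∧-zeroʳ _)))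
                    (∧-identityʳ _))

  module _ {Γ T P : Graph n} (T⊆Γ : T ⊆ᴳ restrict Γ K) (P⊆Γ : P ⊆ᴳ remove Γ K) where

    private
      split : ∀ x y → (T x y ∨ P x y) ∧ inside x y ≡ T x y × (T x y ∨ P x y) ∧ not (inside x y) ≡ P x y
      split x y = go (T x y) (P x y) (inside x y)
                     (restrict-inside {Γ} {x} {y} ∘ T⊆Γ x y) (remove-outside {Γ} {x} {y} ∘ P⊆Γ x y)
        where
        go : ∀ t p k → (t ≡ true → k ≡ true) → (p ≡ true → k ≡ false) →
             (t ∨ p) ∧ k ≡ t × (t ∨ p) ∧ not k ≡ p
        go false false _ _   _   = refl , refl
        go false true  _ _   p⇒¬k rewrite p⇒¬k refl = refl , refl
        go true  false _ t⇒k _   rewrite t⇒k refl = refl , refl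
        go true  true  _ t⇒k p⇒¬k with () ← trans (sym (t⇒k refl)) (p⇒¬k refl)

    restrict-∪ : restrict (T ∪ᴳ P) K ≐ T
    restrict-∪ x y = proj₁ (split x y)

    remove-∪ : remove (T ∪ᴳ P) K ≐ P
    remove-∪ x y = proj₂ (split x y)

    numArcs-∪ : numArcs (T ∪ᴳ P) ≡ numArcs T + numArcs P
    numArcs-∪ = trans (numArcs-restrict+remove (T ∪ᴳ P))
                      (cong₂ _+_ (numArcs-cong restrict-∪) (numArcs-cong remove-∪))

    restrict∪remove-⊆ : (T ∪ᴳ P) ⊆ᴳ Γ
    restrict∪remove-⊆ = ∪-⊆ (λ x y → restrict-⊆ {Γ} x y ∘ T⊆Γ x y) (λ x y → remove-⊆ {Γ} x y ∘ P⊆Γ x y)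

    restrict-remove-disjoint : ∀ x y → T x y ≡ true → P x y ≡ false
    restrict-remove-disjoint x y x→y with P x y in P-x→y
    ... | false = refl
    ... | true with () ← trans (sym (restrict-inside {Γ} {x} {y} (T⊆Γ x y x→y)))
                               (remove-outside {Γ} {x} {y} (P⊆Γ x y P-x→y))

  ∪-injective : ∀ {Γ T P T′ P′ : Graph n} →
                T ⊆ᴳ restrict Γ K → P ⊆ᴳ remove Γ K → T′ ⊆ᴳ restrict Γ K → P′ ⊆ᴳ remove Γ K →
                (T ∪ᴳ P) ≐ (T′ ∪ᴳ P′) → T ≐ T′ × P ≐ P′
  ∪-injective T⊆Γ P⊆Γ T′⊆Γ P′⊆Γ T∪P≐T′∪P′ =
    ≐-trans (≐-sym (restrict-∪ T⊆Γ P⊆Γ)) (≐-trans (restrict-cong T∪P≐T′∪P′) (restrict-∪ T′⊆Γ P′⊆Γ)) ,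
    ≐-trans (≐-sym (remove-∪ T⊆Γ P⊆Γ)) (≐-trans (remove-cong T∪P≐T′∪P′) (remove-∪ T′⊆Γ P′⊆Γ))

module WeightProperties {c ℓ} (R : CommutativeSemiring c ℓ) {n}
                        (ε : Fin n → Fin n → CommutativeSemiring.Carrier R) where

  open CommutativeSemiring R
    using (Carrier; _≈_; _*_; 0#; 1#; reflexive; *-cong; *-identityˡ; *-identityʳ;
           +-cong; +-congˡ; +-identityˡ; +-assoc; zeroˡ; zeroʳ; distribˡ; distribʳ;
           *-commutativeMonoid; +-isCommutativeMonoid)
    renaming (_+_ to _+ᴿ_; refl to ≈-refl; sym to ≈-sym; trans to ≈-trans; setoid to ≈-setoid)
  open Weights R
  open Relation.Binary.Reasoning.Setoid ≈-setoid
  open Membership (≐-setoid n) using () renaming (_∈_ to _∈ₗ_)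
  open UniqueSetoid (≐-setoid n) using (Unique)
  open Permutation (≐-setoid n) using (_↭_)
  open MembershipProperties using (∈-resp-≈; ∈-cartesianProductWith⁺; ∈-cartesianProductWith⁻)
  module RProduct = CommutativeMonoidSum *-commutativeMonoid

  ∏≡sum : ∀ {m} (f : Fin m → Carrier) → ∏ f ≡ RProduct.sum f
  ∏≡sum {zero}  f = refl
  ∏≡sum {suc m} f = cong (f zero *_) (∏≡sum (f ∘ suc))

  ∏-cong : ∀ {m} {f g : Fin m → Carrier} → (∀ i → f i ≈ g i) → ∏ f ≈ ∏ g
  ∏-cong {zero}  f≈g = ≈-refl
  ∏-cong {suc m} f≈g = *-cong (f≈g zero) (∏-cong (f≈g ∘ suc))

  ∏-distrib-* : ∀ {m} (f g : Fin m → Carrier) → ∏ (λ i → f i * g i) ≈ ∏ f * ∏ g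
  ∏-distrib-* f g = begin
    ∏ (λ i → f i * g i)      ≡⟨ ∏≡sum (λ i → f i * g i) ⟩
    RProduct.sum (λ i → f i * g i)  ≈⟨ RProduct.∑-distrib-+ f g ⟩
    RProduct.sum f * RProduct.sum g        ≡⟨ sym (cong₂ _*_ (∏≡sum f) (∏≡sum g)) ⟩
    ∏ f * ∏ g                ∎

  wt-cong : ∀ {S S′ : Graph n} → S ≐ S′ → wt ε S ≈ wt ε S′
  wt-cong S≐S′ = ∏-cong λ x → ∏-cong λ y → reflexive (cong (if_then ε x y else 1#) (S≐S′ x y))

  wt-∪ : ∀ {T P : Graph n} → (∀ x y → T x y ≡ true → P x y ≡ false) → wt ε (T ∪ᴳ P) ≈ wt ε T * wt ε P
  wt-∪ {T} {P} disjoint = begin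
    wt ε (T ∪ᴳ P)
      ≈⟨ ∏-cong (λ x → ∏-cong (λ y → arc x y (T x y) (P x y) refl refl)) ⟩
    ∏ (λ x → ∏ (λ y → ε[ T ] x y * ε[ P ] x y))   ≈⟨ ∏-cong (λ x → ∏-distrib-* (ε[ T ] x) (ε[ P ] x)) ⟩
    ∏ (λ x → ∏ (ε[ T ] x) * ∏ (ε[ P ] x))         ≈⟨ ∏-distrib-* (λ x → ∏ (ε[ T ] x)) (λ x → ∏ (ε[ P ] x)) ⟩
    wt ε T * wt ε P                               ∎
    where
    ε[_] : Graph n → Fin n → Fin n → Carrier
    ε[ S ] x y = if S x y then ε x y else 1#
    arc : ∀ x y t p → T x y ≡ t → P x y ≡ p →
          (if t ∨ p then ε x y else 1#) ≈ (if t then ε x y else 1#) * (if p then ε x y else 1#)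
    arc x y true  true  T-x→y P-x→y with () ← trans (sym P-x→y) (disjoint x y T-x→y)
    arc x y true  false _ _ = ≈-sym (*-identityʳ _)
    arc x y false _     _ _ = ≈-sym (*-identityˡ _)

  wtList-↭ : ∀ {xs ys} → xs ↭ ys → wtList ε xs ≈ wtList ε ys
  wtList-↭ {xs} {ys} xs↭ys = begin
    wtList ε xs                      ≡⟨ sym (foldr-map _+ᴿ_ (wt ε) 0# xs) ⟩
    foldr _+ᴿ_ 0# (map (wt ε) xs)    ≈⟨ foldr-commMonoid ≈-setoid +-isCommutativeMonoid
                                          (↭-map (≐-setoid n) ≈-setoid wt-cong xs↭ys) ⟩
    foldr _+ᴿ_ 0# (map (wt ε) ys)    ≡⟨ foldr-map _+ᴿ_ (wt ε) 0# ys ⟩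
    wtList ε ys                      ∎
    where open PermutationProperties using (foldr-commMonoid) renaming (map⁺ to ↭-map)

  wtList-++ : ∀ xs ys → wtList ε (xs ++ ys) ≈ wtList ε xs +ᴿ wtList ε ys
  wtList-++ []       ys = ≈-sym (+-identityˡ _)
  wtList-++ (x ∷ xs) ys = ≈-trans (+-congˡ (wtList-++ xs ys)) (≈-sym (+-assoc _ _ _))

  module _ {Γ : Graph n} (K : Subset n) where

    open Restriction K

    wtList-map-∪ : ∀ {T Ps} → T ⊆ᴳ restrict Γ K → All (_⊆ᴳ remove Γ K) Ps →
                   wtList ε (map (T ∪ᴳ_) Ps) ≈ wt ε T * wtList ε Ps
    wtList-map-∪ T⊆Γ []           = ≈-sym (zeroʳ _)
    wtList-map-∪ T⊆Γ (P⊆Γ ∷ Ps⊆Γ) =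
      ≈-trans (+-cong (wt-∪ (restrict-remove-disjoint T⊆Γ P⊆Γ)) (wtList-map-∪ T⊆Γ Ps⊆Γ))
              (≈-sym (distribˡ _ _ _))

    wtList-⊗ : ∀ {Ts Ps} → All (_⊆ᴳ restrict Γ K) Ts → All (_⊆ᴳ remove Γ K) Ps →
               wtList ε (Ts ⊗ Ps) ≈ wtList ε Ts * wtList ε Ps
    wtList-⊗ []            Ps⊆Γ = ≈-sym (zeroˡ _)
    wtList-⊗ {T ∷ Ts} {Ps} (T⊆Γ ∷ Ts⊆Γ) Ps⊆Γ = begin
      wtList ε (map (T ∪ᴳ_) Ps ++ Ts ⊗ Ps)               ≈⟨ wtList-++ (map (T ∪ᴳ_) Ps) (Ts ⊗ Ps) ⟩
      wtList ε (map (T ∪ᴳ_) Ps) +ᴿ wtList ε (Ts ⊗ Ps)    ≈⟨ +-cong (wtList-map-∪ T⊆Γ Ps⊆Γ)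
                                                                   (wtList-⊗ Ts⊆Γ Ps⊆Γ) ⟩
      wt ε T * wtList ε Ps +ᴿ wtList ε Ts * wtList ε Ps  ≈⟨ ≈-sym (distribʳ _ _ _) ⟩
      (wt ε T +ᴿ wtList ε Ts) * wtList ε Ps              ∎

    Unique-⊗ : ∀ {Ts Ps} → All (_⊆ᴳ restrict Γ K) Ts → All (_⊆ᴳ remove Γ K) Ps →
               Unique Ts → Unique Ps → Unique (Ts ⊗ Ps)
    Unique-⊗ []            _    _              _   = []
    Unique-⊗ {T ∷ Ts} {Ps} (T⊆Γ ∷ Ts⊆Γ) Ps⊆Γ (T∉Ts ∷ Ts!) Ps! =
      AllPairsProperties.++⁺ (Unique-map Ps⊆Γ Ps!) (Unique-⊗ Ts⊆Γ Ps⊆Γ Ts! Ps!)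
                             (AllProperties.map⁺ (All.map separated Ps⊆Γ))
      where
      Unique-map : ∀ {Ps} → All (_⊆ᴳ remove Γ K) Ps → Unique Ps → Unique (map (T ∪ᴳ_) Ps)
      Unique-map []            []            = []
      Unique-map (P⊆Γ ∷ Ps⊆Γ) (P∉Ps ∷ Ps!) =
        AllProperties.map⁺ (All.zipWith (λ (P≉P′ , P′⊆Γ) T∪P≐T∪P′ →
                                           P≉P′ (proj₂ (∪-injective T⊆Γ P⊆Γ T⊆Γ P′⊆Γ T∪P≐T∪P′)))
                                        (P∉Ps , Ps⊆Γ))
        ∷ Unique-map Ps⊆Γ Ps!
      separated : ∀ {P} → P ⊆ᴳ remove Γ K → All (λ S → ¬ (T ∪ᴳ P) ≐ S) (Ts ⊗ Ps)
      separated P⊆Γ = All-⊗ (All.zipWith id (T∉Ts , Ts⊆Γ)) Ps⊆Γ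
        (λ (T≉T′ , T′⊆Γ) P′⊆Γ T∪P≐T′∪P′ → T≉T′ (proj₁ (∪-injective T⊆Γ P⊆Γ T′⊆Γ P′⊆Γ T∪P≐T′∪P′)))

    wtList-⊙ : ∀ {𝒜 ℬ 𝒞 : Graph n → Set} → (∀ {T} → 𝒜 T → T ⊆ᴳ restrict Γ K) →
               (∀ {P} → ℬ P → P ⊆ᴳ remove Γ K) →
               SameSet 𝒞 (𝒜 ⊙ ℬ) → ∀ {L₁ L₂ L₃} →
               Enumerates 𝒞 L₁ → Enumerates 𝒜 L₂ → Enumerates ℬ L₃ →
               wtList ε L₁ ≈ wtList ε L₂ * wtList ε L₃
    wtList-⊙ {𝒜} {ℬ} {𝒞} 𝒜-inside ℬ-outside 𝒞≈𝒜⊙ℬ {L₁} {L₂} {L₃}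
             (L₁-𝒞 , L₁-complete , L₁!) (L₂-𝒜 , L₂-complete , L₂!) (L₃-ℬ , L₃-complete , L₃!) = begin
      wtList ε L₁               ≈⟨ wtList-↭ (unique-sameMembers⇒↭ (≐-setoid n) L₁! L₂⊗L₃!
                                                                   L₁⊆L₂⊗L₃ L₂⊗L₃⊆L₁) ⟩
      wtList ε (L₂ ⊗ L₃)        ≈⟨ wtList-⊗ L₂-inside L₃-outside ⟩
      wtList ε L₂ * wtList ε L₃ ∎
      where
      L₂-inside = All.map 𝒜-inside L₂-𝒜
      L₃-outside = All.map ℬ-outside L₃-ℬ
      L₂⊗L₃! = Unique-⊗ L₂-inside L₃-outside L₂! L₃!

      L₁⊆L₂⊗L₃ : ∀ {S} → S ∈ₗ L₁ → S ∈ₗ L₂ ⊗ L₃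
      L₁⊆L₂⊗L₃ S∈L₁ =
        let S′-𝒞 , S≐S′ = lookupAny L₁-𝒞 S∈L₁
            T , P , T-𝒜 , P-ℬ , S′≐T∪P = proj₁ (𝒞≈𝒜⊙ℬ _) S′-𝒞
        in ∈-resp-≈ (≐-setoid n) (≐-sym (≐-trans S≐S′ S′≐T∪P))
             (∈-cartesianProductWith⁺ (≐-setoid n) (≐-setoid n) (≐-setoid n) ∪-cong
                (L₂-complete T T-𝒜) (L₃-complete P P-ℬ))

      L₂⊗L₃⊆L₁ : ∀ {S} → S ∈ₗ L₂ ⊗ L₃ → S ∈ₗ L₁
      L₂⊗L₃⊆L₁ {S} S∈L₂⊗L₃ =
        let T , P , T∈L₂ , P∈L₃ , S≐T∪P =
              ∈-cartesianProductWith⁻ (≐-setoid n) (≐-setoid n) (≐-setoid n) _∪ᴳ_ L₂ L₃ S∈L₂⊗L₃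
            T′-𝒜 , T≐T′ = lookupAny L₂-𝒜 T∈L₂
            P′-ℬ , P≐P′ = lookupAny L₃-ℬ P∈L₃
        in L₁-complete S (proj₂ (𝒞≈𝒜⊙ℬ S) (_ , _ , T′-𝒜 , P′-ℬ , ≐-trans S≐T∪P (∪-cong T≐T′ P≐P′)))

-- Vertex sets without entering arcs, and undominated knots

module PredecessorClosed {n} {Γ : Graph n} {K : Subset n}
  (closed : ∀ x y → Γ x y ≡ true → lookup K y ≡ true → lookup K x ≡ true) where

  open Restriction K

  module _ {G : Graph n} (G⊆Γ : G ⊆ᴳ Γ) where

    Reach-into : ∀ {a b} → Reach G a b → lookup K b ≡ true →
                 lookup K a ≡ true × Reach (restrict G K) a b
    Reach-into here b∈K = b∈K , here
    Reach-into {a} (step {y = c} a→c c⇝b) b∈K =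
      let c∈K , c⇝b′ = Reach-into c⇝b b∈K
          a∈K = closed a c (G⊆Γ a c a→c) c∈K
      in a∈K , step (restrict-arc {G = G} a→c (cong₂ _∧_ a∈K c∈K)) c⇝b′

    Reach-outside : ∀ {a b} → Reach G a b → lookup K a ≡ false → Reach (remove G K) a b
    Reach-outside here _ = here
    Reach-outside {a} (step {y = c} a→c c⇝b) a∉K with lookup K c in c∈?K
    ... | true  with () ← trans (sym (closed a c (G⊆Γ a c a→c) c∈?K)) a∉K
    ... | false = step (remove-arc {G = G} a→c (cong (_∧ lookup K c) a∉K)) (Reach-outside c⇝b c∈?K)

    Reach-exit : ∀ {a b} → Reach G a b → lookup K a ≡ true →
                 ∃[ z ] (lookup K z ≡ true × Reach (remove G K) z b)
    Reach-exit {a} here a∈K = a , a∈K , here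
    Reach-exit {a} (step {y = c} a→c c⇝b) a∈K with lookup K c in c∈?K
    ... | true  = Reach-exit c⇝b c∈?K
    ... | false = a , a∈K , step (remove-arc {G = G} a→c (trans (cong (lookup K a ∧_) c∈?K) (∧-zeroʳ _)))
                                 (Reach-outside c⇝b c∈?K)

    circuit-split : HasCircuit G → HasCircuit (restrict G K) ⊎ HasCircuit (remove G K)
    circuit-split (z , y , z→y , y⇝z) with lookup K z in z∈?K | lookup K y in y∈?K
    ... | true  | _     = let y∈K , y⇝z′ = Reach-into y⇝z z∈?K in
                          inj₁ (z , y , restrict-arc {G = G} z→y (cong₂ _∧_ z∈?K y∈K) , y⇝z′)
    ... | false | false = inj₂ (z , y , remove-arc {G = G} z→y (cong (_∧ lookup K y) z∈?K) ,
                                Reach-outside y⇝z y∈?K)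
    ... | false | true  with () ← trans (sym (closed z y (G⊆Γ z y z→y) y∈?K)) z∈?K

    inDegree-restrict : ∀ {y} → lookup K y ≡ true → inDegree (restrict G K) y ≡ inDegree G y
    inDegree-restrict {y} y∈K = ∑-cong λ x → cong b2n (restrict-arc-into x)
      where
      restrict-arc-into : ∀ x → restrict G K x y ≡ G x y
      restrict-arc-into x with G x y in x→y
      ... | false = refl
      ... | true  = cong₂ _∧_ (closed x y (G⊆Γ x y x→y) y∈K) y∈K

    DivergingForest-glue : DivergingForest (restrict G K) → DivergingForest (remove G K) →
                           DivergingForest G
    DivergingForest-glue (inside-acyclic , inside-inDegree≤1) (outside-acyclic , outside-inDegree≤1) =
      reduce ∘ Data.Sum.map inside-acyclic outside-acyclic ∘ circuit-split , inDegree≤1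
      where
      inDegree≤1 : ∀ y → inDegree G y ≤ 1
      inDegree≤1 y with lookup K y in y∈?K
      ... | true  = subst (_≤ 1) (inDegree-restrict y∈?K) (inside-inDegree≤1 y)
      ... | false = subst (_≤ 1) (inDegree-remove {G = G} y∈?K) (outside-inDegree≤1 y)

  ∪-spanningForest : ∀ {T P} → T ⊆ᴳ restrict Γ K → DivergingForest T →
                     P ⊆ᴳ remove Γ K → DivergingForest P → SpanningForest Γ (T ∪ᴳ P)
  ∪-spanningForest T⊆Γ T-forest P⊆Γ P-forest =
    T∪P⊆Γ , DivergingForest-glue T∪P⊆Γ (DivergingForest-mono (≐⇒⊆ᴳ (restrict-∪ T⊆Γ P⊆Γ)) T-forest)
                                        (DivergingForest-mono (≐⇒⊆ᴳ (remove-∪ T⊆Γ P⊆Γ)) P-forest)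
    where T∪P⊆Γ = restrict∪remove-⊆ T⊆Γ P⊆Γ

  remove-maxOutForest : ∀ {F} → MaxOutForest Γ F → MaxOutForest (remove Γ K) (remove F K)
  remove-maxOutForest {F} ((F⊆Γ , F-forest) , F-max) =
    (remove-mono F⊆Γ , DivergingForest-mono remove-⊆ F-forest) , remove-max
    where
    remove-max : ∀ P → SpanningForest (remove Γ K) P → numArcs P ≤ numArcs (remove F K)
    remove-max P (P⊆Γ , P-forest) = +-cancelˡ-≤ (numArcs (restrict F K)) _ _ (begin
      numArcs (restrict F K) + numArcs P             ≡⟨ sym (numArcs-∪ T⊆Γ P⊆Γ) ⟩
      numArcs (restrict F K ∪ᴳ P)                    ≤⟨ F-max _ (∪-spanningForest T⊆Γ T-forest
                                                                                   P⊆Γ P-forest) ⟩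
      numArcs F                                      ≡⟨ numArcs-restrict+remove F ⟩
      numArcs (restrict F K) + numArcs (remove F K)  ∎)
      where
      open ≤-Reasoning
      T⊆Γ = restrict-mono F⊆Γ
      T-forest = DivergingForest-mono restrict-⊆ F-forest

module Knot {n} {Γ : Graph n} {K : Subset n} (knot : UndominatedKnot Γ K) where

  open Restriction K

  private
    ∈⇒lookup : ∀ {x} → x ∈ K → lookup K x ≡ true
    ∈⇒lookup = []=⇒lookup

    lookup⇒∈ : ∀ {x} → lookup K x ≡ true → x ∈ K
    lookup⇒∈ = lookup⇒[]= _ K

    K-connected : ∀ {x y} → lookup K x ≡ true → lookup K y ≡ true → Reach Γ x y
    K-connected x∈K y∈K = proj₁ (proj₂ knot) _ _ (lookup⇒∈ x∈K) (lookup⇒∈ y∈K)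

  open PredecessorClosed {K = K} (λ x y x→y y∈K → ∈⇒lookup (proj₂ (proj₂ knot) x y x→y (lookup⇒∈ y∈K)))

  module _ {F : Graph n} (F-max : MaxOutForest Γ F) where

    private
      F⊆Γ = proj₁ (proj₁ F-max)
      F-forest = proj₂ (proj₁ F-max)

    maxOutForest-K-root-unique : ∀ {r₁ r₂} → lookup K r₁ ≡ true → lookup K r₂ ≡ true →
                                 IsRoot F r₁ → IsRoot F r₂ → r₁ ≡ r₂
    maxOutForest-K-root-unique r₁∈K r₂∈K r₁-root r₂-root = decidable-stable (_ ≟ᶠ _) λ r₁≢r₂ →
      maxOutForest-root-reaches F-max r₂-root (K-connected r₁∈K r₂∈K)
        (λ r₂⇝r₁ → r₁≢r₂ (sym (Reach-root r₁-root r₂⇝r₁)))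

    maxOutForest-K-root : ∃[ r ] (lookup K r ≡ true × IsRoot F r)
    maxOutForest-K-root =
      let k , k∈K = proj₁ knot
          r , r-root , r⇝k = rootedAbove (proj₁ F-forest) k
      in r , proj₁ (Reach-into F⊆Γ r⇝k (∈⇒lookup k∈K)) , r-root

    restrict-maxOutForest : ∀ {r} → r ∈ K → IsRoot F r → 𝒯[ r ] Γ K (restrict F K)
    restrict-maxOutForest {r} r∈K r-root =
      restrict-mono F⊆Γ , DivergingForest-mono restrict-⊆ F-forest , r∈K , r-reaches
      where
      r-reaches : ∀ k → k ∈ K → Reach (restrict F K) r k
      r-reaches k k∈K with rootedAbove (proj₁ F-forest) k
      ... | r′ , r′-root , r′⇝k with Reach-into F⊆Γ r′⇝k (∈⇒lookup k∈K)
      ...   | r′∈K , r′⇝k′ rewrite maxOutForest-K-root-unique r′∈K (∈⇒lookup r∈K) r′-root r-root = r′⇝k′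

  module _ {j} {T : Graph n} (T-tree : 𝒯[ j ] Γ K T) where

    private
      T⊆Γ = proj₁ T-tree
      T-forest = proj₁ (proj₂ T-tree)
      j∈K = proj₁ (proj₂ (proj₂ T-tree))
      j-reaches = proj₂ (proj₂ (proj₂ T-tree))

      T-arc-inside : ∀ {x y} → T x y ≡ true → lookup K x ∧ lookup K y ≡ true
      T-arc-inside {x} {y} x→y = restrict-inside {Γ} {x} {y} (T⊆Γ x y x→y)

    𝒯-root : IsRoot T j
    𝒯-root = noArc⇒IsRoot {G = T} no-arc
      where
      no-arc : ∀ x → T x j ≡ false
      no-arc x with T x j in x→j
      ... | false = refl
      ... | true  = ⊥-elim (proj₁ T-forest
                      (x , j , x→j , j-reaches x (lookup⇒∈ (∧-conicalˡ _ _ (T-arc-inside x→j)))))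

    𝒯-inDegree : ∀ y → inDegree T y + b2n (does (y ≟ᶠ j)) ≡ b2n (lookup K y)
    𝒯-inDegree y with y ≟ᶠ j
    ... | yes refl = trans (cong (_+ 1) 𝒯-root) (cong b2n (sym (∈⇒lookup j∈K)))
    ... | no y≢j with lookup K y in y∈?K
    ...   | true  = let _ , _ , c→y = Reach-last (j-reaches y (lookup⇒∈ y∈?K)) (y≢j ∘ sym) in
                    trans (+-identityʳ _) (≤-antisym (proj₂ T-forest y) (arc⇒1≤inDegree {G = T} c→y))
    ...   | false = trans (+-identityʳ _) (noArc⇒IsRoot {G = T} no-arc)
      where
      no-arc : ∀ x → T x y ≡ false
      no-arc x with T x y in x→y
      ... | false = refl
      ... | true with () ← trans (sym (∧-conicalʳ _ _ (T-arc-inside x→y))) y∈?K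

    𝒯-numArcs+1 : numArcs T + 1 ≡ ∑ (λ y → b2n (lookup K y))
    𝒯-numArcs+1 = begin
      numArcs T + 1                                     ≡⟨ cong₂ _+_ (numArcs≡∑inDegree T)
                                                                      (sym (∑-indicator j)) ⟩
      ∑ (inDegree T) + ∑ (λ y → b2n (does (y ≟ᶠ j)))    ≡⟨ sym (∑-distrib-+ (inDegree T) _) ⟩
      ∑ (λ y → inDegree T y + b2n (does (y ≟ᶠ j)))      ≡⟨ ∑-cong 𝒯-inDegree ⟩
      ∑ (λ y → b2n (lookup K y))                        ∎
      where open ≡-Reasoning

  𝒯-sameNumArcs : ∀ {j j′} {T T′ : Graph n} → 𝒯[ j ] Γ K T → 𝒯[ j′ ] Γ K T′ → numArcs T ≡ numArcs T′
  𝒯-sameNumArcs T-tree T′-tree = +-cancelʳ-≡ 1 _ _ (trans (𝒯-numArcs+1 T-tree) (sym (𝒯-numArcs+1 T′-tree)))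

  module _ {F₀ : Graph n} (F₀-max : MaxOutForest Γ F₀) where

    private
      T₀-tree : 𝒯[ _ ] Γ K (restrict F₀ K)
      T₀-tree = let _ , r∈K , r-root = maxOutForest-K-root F₀-max in
                restrict-maxOutForest F₀-max (lookup⇒∈ r∈K) r-root

    𝓕⇒maxOutForest : ∀ {S} → 𝓕 Γ (numArcs F₀) S → MaxOutForest Γ S
    𝓕⇒maxOutForest (S-forest , S-arcs) =
      S-forest , λ F F-forest → subst (numArcs F ≤_) (sym S-arcs) (proj₂ F₀-max F F-forest)

    maxOutForest⇒⊙ : ∀ {S} → MaxOutForest Γ S → (𝒯 Γ K ⊙ 𝒫 Γ K) S
    maxOutForest⇒⊙ {S} S-max =
      let r , r∈K , r-root = maxOutForest-K-root S-max in
      restrict S K , remove S K , (r , restrict-maxOutForest S-max (lookup⇒∈ r∈K) r-root) ,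
      remove-maxOutForest S-max , restrict∪remove S

    ⊙⇒𝓕 : ∀ {S} → (𝒯 Γ K ⊙ 𝒫 Γ K) S → 𝓕 Γ (numArcs F₀) S
    ⊙⇒𝓕 {S} (T , P , (j , T-tree) , P-max , S≐T∪P) =
      SpanningForest-mono (≐⇒⊆ᴳ S≐T∪P) T∪P-forest , (begin
        numArcs S                                        ≡⟨ numArcs-cong S≐T∪P ⟩
        numArcs (T ∪ᴳ P)                                 ≡⟨ numArcs-∪ T⊆Γ P⊆Γ ⟩
        numArcs T + numArcs P                            ≡⟨ cong₂ _+_ (𝒯-sameNumArcs T-tree T₀-tree)
                                                                      (maxOutForest-numArcs P-max P₀-max) ⟩
        numArcs (restrict F₀ K) + numArcs (remove F₀ K)  ≡⟨ sym (numArcs-restrict+remove F₀) ⟩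
        numArcs F₀                                       ∎)
      where
      open ≡-Reasoning
      T⊆Γ = proj₁ T-tree
      P⊆Γ = proj₁ (proj₁ P-max)
      T∪P-forest = ∪-spanningForest T⊆Γ (proj₁ (proj₂ T-tree)) P⊆Γ (proj₂ (proj₁ P-max))
      P₀-max = remove-maxOutForest F₀-max

    𝓕≈𝒯⊙𝒫 : SameSet (𝓕 Γ (numArcs F₀)) (𝒯 Γ K ⊙ 𝒫 Γ K)
    𝓕≈𝒯⊙𝒫 S = maxOutForest⇒⊙ ∘ 𝓕⇒maxOutForest , ⊙⇒𝓕

    𝓕[⇒]⇒⊙ : ∀ {j i S} → j ∈ K → 𝓕[ j ⇒ i ] Γ (numArcs F₀) S → (𝒯[ j ] Γ K ⊙ 𝒫[K⇒ i ] Γ K) S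
    𝓕[⇒]⇒⊙ {S = S} j∈K (S-𝓕 , j-root , j⇝i) =
      let S-max = 𝓕⇒maxOutForest S-𝓕
          z , z∈K , z⇝i = Reach-exit (proj₁ (proj₁ S-max)) j⇝i (∈⇒lookup j∈K)
      in restrict S K , remove S K , restrict-maxOutForest S-max j∈K j-root ,
         (remove-maxOutForest S-max , z , lookup⇒∈ z∈K , z⇝i) , restrict∪remove S

    ⊙⇒𝓕[⇒] : ∀ {j i S} → (𝒯[ j ] Γ K ⊙ 𝒫[K⇒ i ] Γ K) S → 𝓕[ j ⇒ i ] Γ (numArcs F₀) S
    ⊙⇒𝓕[⇒] {j} {i} {S} (T , P , T-tree , (P-max , z , z∈K , z⇝i) , S≐T∪P) = S-𝓕 , j-root , j⇝i
      where
      S-𝓕 = ⊙⇒𝓕 (T , P , (j , T-tree) , P-max , S≐T∪P)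
      T⊆Γ = proj₁ T-tree
      P⊆Γ = proj₁ (proj₁ P-max)
      j∈K = proj₁ (proj₂ (proj₂ T-tree))
      j-root : IsRoot S j
      j-root = begin
        inDegree S j                      ≡⟨ inDegree-cong S≐T∪P j ⟩
        inDegree (T ∪ᴳ P) j               ≡⟨ sym (inDegree-restrict (restrict∪remove-⊆ T⊆Γ P⊆Γ)
                                                                    (∈⇒lookup j∈K)) ⟩
        inDegree (restrict (T ∪ᴳ P) K) j  ≡⟨ inDegree-cong (restrict-∪ T⊆Γ P⊆Γ) j ⟩
        inDegree T j                      ≡⟨ 𝒯-root T-tree ⟩
        0                                 ∎
        where open ≡-Reasoning
      j⇝i : Reach S j i
      j⇝i = Reach-mono (≐⇒⊆ᴳ (≐-sym S≐T∪P))
              (Reach-trans (Reach-mono ∪-⊆ˡ (proj₂ (proj₂ (proj₂ T-tree)) z z∈K)) (Reach-mono ∪-⊆ʳ z⇝i))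

    𝓕[⇒]≈𝒯⊙𝒫 : ∀ {j} i → j ∈ K → SameSet (𝓕[ j ⇒ i ] Γ (numArcs F₀)) (𝒯[ j ] Γ K ⊙ 𝒫[K⇒ i ] Γ K)
    𝓕[⇒]≈𝒯⊙𝒫 i j∈K S = 𝓕[⇒]⇒⊙ j∈K , ⊙⇒𝓕[⇒]

proposition9 : ∀ {c ℓ} (R : CommutativeSemiring c ℓ) →
    let open CommutativeSemiring R in
    let open Weights R in
    (n : ℕ) (Γ : Graph n) (ε : Fin n → Fin n → Carrier) (v : ℕ) (K : Subset n) →
    Loopless Γ → ForestDimension Γ v → UndominatedKnot Γ K →
    (SameSet (𝓕 Γ (n ∸ v)) (𝒯 Γ K ⊙ 𝒫 Γ K)
      × (∀ L₁ L₂ L₃ →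
          Enumerates (𝓕 Γ (n ∸ v)) L₁ → Enumerates (𝒯 Γ K) L₂ → Enumerates (𝒫 Γ K) L₃ →
          wtList ε L₁ ≈ wtList ε L₂ * wtList ε L₃))
    × (∀ j i → j ∈ K →
        SameSet (𝓕[ j ⇒ i ] Γ (n ∸ v)) (𝒯[ j ] Γ K ⊙ 𝒫[K⇒ i ] Γ K)
        × (∀ L₁ L₂ L₃ →
            Enumerates (𝓕[ j ⇒ i ] Γ (n ∸ v)) L₁ → Enumerates (𝒯[ j ] Γ K) L₂ →
            Enumerates (𝒫[K⇒ i ] Γ K) L₃ →
            wtList ε L₁ ≈ wtList ε L₂ * wtList ε L₃))
proposition9 R n Γ ε _ K _ (F₀ , F₀-max , refl) knot
  rewrite ∸numRoots≡numArcs (proj₂ (proj₁ F₀-max)) =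
    (𝓕≈𝒯⊙𝒫 F₀-max , λ _ _ _ → wtList-⊙ K (proj₁ ∘ proj₂) (proj₁ ∘ proj₁) (𝓕≈𝒯⊙𝒫 F₀-max)) ,
    λ j i j∈K → 𝓕[⇒]≈𝒯⊙𝒫 F₀-max i j∈K ,
                λ _ _ _ → wtList-⊙ K proj₁ (proj₁ ∘ proj₁ ∘ proj₁) (𝓕[⇒]≈𝒯⊙𝒫 F₀-max i j∈K)
  where
  open Knot knot
  open WeightProperties R ε
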